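{- For every integer $n\geq 1$: (1) the number of overpartitions $\pi$ of $n$ with $\ell_{N>O}(\pi)$ even (resp. odd) equals the number of overpartitions $\lambda$ of $n$ with $\ell_{N<O}(\lambda)$ even (resp. odd); (2) the number of overpartitions $\pi$ of $n$ such that overlined parts appear and $\ell_{N>O}(\pi)$ is even (resp. odd) equals the number of overpartitions $\lambda$ of $n$ such that overlined parts appear and $\ell_{N<O}(\lambda)$ is even (resp. odd).
   Context: An overpartition of $n$ is a partition of $n$ (finite non-increasing sequence of positive integers summing to $n$) in which the first occurrence of each distinct part size may be overlined. A part is of size $t$ if it equals $t$ or $\overline{t}$. For an overpartition $\pi$, let $SO(\pi)$ be the size of the smallest overlined part of $\pi$ if $\pi$ has overlined parts and $0$ otherwise, and let $\widetilde{LO}(\pi)$ be the size of the largest overlined part of $\pi$ if $\pi$ has overlined parts and $+\infty$ otherwise. $\ell_{N>O}(\pi)$ is the number of non-overlined parts of $\pi$ of size $>SO(\pi)$, and $\ell_{N<O}(\pi)$ is the number of non-overlined parts of $\pi$ of size $<\widetilde{LO}(\pi)$. -}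

module Defs where

open import Data.Nat using (ℕ; zero; suc; _+_; _≤_; _<_; _<ᵇ_; _%_; _⊔_; _⊓_)
open import Data.Bool using (Bool; true; false; not; _∧_; if_then_else_)
open import Data.Maybe using (Maybe; just; nothing)
open import Data.Product using (_×_; proj₁; proj₂; Σ; _,_)
open import Data.Sum using (_⊎_)
open import Data.List using (List; []; _∷_)
open import Data.List.Relation.Unary.All using (All)
open import Data.List.Relation.Unary.Linked using (Linked)
open import Relation.Binary.PropositionalEquality using (_≡_)
open import Function.Bundles using (_↔_)

-- A part: (size, overlined?)
Part : Set
Part = ℕ × Bool

-- Adjacent parts p, q (q right after p): sizes non-increasing, and if q has
-- the same size as p then q is not overlined (only the first occurrence of a
-- size may be overlined).  Written as a disjoint sum so it is propositional.
AdjOK : Part → Part → Set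
AdjOK (a , x) (b , y) = (b < a) ⊎ ((b ≡ a) × (y ≡ false))

sizeSum : List Part → ℕ
sizeSum [] = 0
sizeSum ((t , _) ∷ π) = t + sizeSum π

IsOverpartition : ℕ → List Part → Set
IsOverpartition n π = All (λ p → 1 ≤ proj₁ p) π × Linked AdjOK π × sizeSum π ≡ n

Overpartition : ℕ → Set
Overpartition n = Σ (List Part) (IsOverpartition n)

overlinedSizes : List Part → List ℕ
overlinedSizes [] = []
overlinedSizes ((t , true) ∷ π) = t ∷ overlinedSizes π
overlinedSizes ((t , false) ∷ π) = overlinedSizes π

minimumM : List ℕ → Maybe ℕ
minimumM [] = nothing
minimumM (x ∷ xs) with minimumM xs
... | nothing = just x
... | just m = just (x ⊓ m)

maximumM : List ℕ → Maybe ℕ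
maximumM [] = nothing
maximumM (x ∷ xs) with maximumM xs
... | nothing = just x
... | just m = just (x ⊔ m)

SO : List Part → ℕ
SO π with minimumM (overlinedSizes π)
... | nothing = 0
... | just m = m

-- LO~(π): largest overlined size, +∞ (encoded as nothing) if none
LO∞ : List Part → Maybe ℕ
LO∞ π = maximumM (overlinedSizes π)

_<∞ᵇ_ : ℕ → Maybe ℕ → Bool
t <∞ᵇ nothing = true
t <∞ᵇ just L = t <ᵇ L

countNon : (ℕ → Bool) → List Part → ℕ
countNon P [] = 0
countNon P ((t , true) ∷ π) = countNon P π
countNon P ((t , false) ∷ π) = (if P t then 1 else 0) + countNon P π

ℓN>O : List Part → ℕ
ℓN>O π = countNon (λ t → SO π <ᵇ t) π

ℓN<O : List Part → ℕ
ℓN<O π = countNon (λ t → t <∞ᵇ LO∞ π) π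

HasOverlined : List Part → Set
HasOverlined π = Σ ℕ (λ t → Σ (List ℕ) (λ ts → overlinedSizes π ≡ t ∷ ts))

OverpartitionsWith : ℕ → (List Part → Set) → Set
OverpartitionsWith n P = Σ (List Part) (λ π → IsOverpartition n π × P π)

-- An overpartition is a partition together with overline flags on the first occurrences
-- of its distinct sizes d₁ > ⋯ > d_k.  Keeping the partition fixed, the bijection rotates
-- the flag vector, (f₁ , f₂ , … , f_k) ↦ (f₂ , … , f_k , x).  If one of f₂ … f_k is set,
-- toggling the flag of d₁ changes ℓ_{N>O} by exactly one and toggling the flag of d_k
-- changes ℓ_{N<O} by exactly one; so x can be chosen to give ℓ_{N<O} of the image the
-- parity of ℓ_{N>O} of the source, and f₁ is recovered from the image in the same way.
-- Otherwise x = f₁: either nothing is overlined and both statistics count every part, or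
-- only d₁ is overlined before and only d_k after, and both statistics vanish.  Rotation
-- preserves the presence of overlined parts, which gives the second pair of bijections.

module Submission where

open import Defs
open import Axiom.UniquenessOfIdentityProofs using (module Decidable⇒UIP)
open import Data.Bool using (Bool; true; false; not; _∨_; if_then_else_)
import Data.Bool.Properties as Bool
open import Data.Bool.ListAction using (or)
open import Data.Empty using (⊥-elim)
open import Data.List using (List; []; _∷_; _++_; _∷ʳ_; length; map; initLast; _∷ʳ′_)
open import Data.List.Properties using (++-identityʳ; ≡-dec)
open import Data.List.Relation.Unary.All using (All; []; _∷_)
import Data.List.Relation.Unary.All as All
import Data.List.Relation.Unary.All.Properties as All
open import Data.List.Relation.Unary.Linked using (Linked; []; [-]; _∷_)
import Data.List.Relation.Unary.Linked as Linked
import Data.List.Relation.Unary.Linked.Properties as Linked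
open import Data.Maybe using (Maybe; just; nothing)
open import Data.Nat using (ℕ; zero; suc; _+_; _≤_; _<_; _≥_; _≡ᵇ_; _<ᵇ_; _%_; _⊔_; _⊓_)
open import Data.Nat.ListAction using (sum)
open import Data.Nat.Properties
open import Data.Product using (Σ; _×_; _,_; proj₁)
open import Data.Product.Properties using (Σ-≡,≡→≡)
open import Data.Sum using (_⊎_; inj₁; inj₂)
open import Function using (_∘_)
open import Function.Bundles using (_↔_; mk↔ₛ′)
open import Relation.Nullary using (Irrelevant)
open import Relation.Nullary.Reflects using (Reflects; ofʸ; ofⁿ; fromEquivalence)
open import Relation.Binary.PropositionalEquality
open ≡-Reasoning


≡ᵇ-reflects-≡ : ∀ m n → Reflects (m ≡ n) (m ≡ᵇ n)
≡ᵇ-reflects-≡ m n = fromEquivalence (≡ᵇ⇒≡ m n) (≡⇒≡ᵇ m n)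

<ᵇ-true : ∀ {m n} → m < n → (m <ᵇ n) ≡ true
<ᵇ-true {m} {n} m<n with m <ᵇ n | <ᵇ-reflects-< m n
... | true | _ = refl
... | false | ofⁿ m≮n = ⊥-elim (m≮n m<n)

<ᵇ-false : ∀ {m n} → n ≤ m → (m <ᵇ n) ≡ false
<ᵇ-false {m} {n} n≤m with m <ᵇ n | <ᵇ-reflects-< m n
... | true | ofʸ m<n = ⊥-elim (<⇒≱ m<n n≤m)
... | false | _ = refl

parity-suc : ∀ m → (m % 2 ≡ 0 × suc m % 2 ≡ 1) ⊎ (m % 2 ≡ 1 × suc m % 2 ≡ 0)
parity-suc zero = inj₁ (refl , refl)
parity-suc (suc m) with parity-suc m
... | inj₁ (m0 , sm1) = inj₂ (sm1 , m0)
... | inj₂ (m1 , sm0) = inj₁ (sm0 , m1)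

suc-%2-≢ : ∀ m → suc m % 2 ≢ m % 2
suc-%2-≢ m with parity-suc m
... | inj₁ (m0 , sm1) = λ e → 1+n≢0 (trans (sym sm1) (trans e m0))
... | inj₂ (m1 , sm0) = λ e → 1+n≢0 (trans (sym m1) (trans (sym e) sm0))

%2-suc-≡ : ∀ m n → suc m % 2 ≢ n % 2 → m % 2 ≡ n % 2
%2-suc-≡ m n sm≢n with parity-suc m | parity-suc n
... | inj₁ (m0 , _) | inj₁ (n0 , _) = trans m0 (sym n0)
... | inj₁ (_ , sm1) | inj₂ (n1 , _) = ⊥-elim (sm≢n (trans sm1 (sym n1)))
... | inj₂ (_ , sm0) | inj₁ (n0 , _) = ⊥-elim (sm≢n (trans sm0 (sym n0)))
... | inj₂ (m1 , _) | inj₂ (n1 , _) = trans m1 (sym n1)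

or-∷ʳ : ∀ fs x → or (fs ∷ʳ x) ≡ or fs ∨ x
or-∷ʳ [] x = Bool.∨-identityʳ x
or-∷ʳ (f ∷ fs) x = trans (cong (f ∨_) (or-∷ʳ fs x)) (sym (Bool.∨-assoc f (or fs) x))

or-∷ʳ-false : ∀ fs → or (fs ∷ʳ false) ≡ or fs
or-∷ʳ-false fs = trans (or-∷ʳ fs false) (Bool.∨-identityʳ (or fs))

initLast-∷ʳ : ∀ {A : Set} (xs : List A) x → initLast (xs ∷ʳ x) ≡ xs ∷ʳ′ x
initLast-∷ʳ [] x = refl
initLast-∷ʳ (y ∷ xs) x rewrite initLast-∷ʳ xs x = refl

length-∷ʳ : ∀ {A : Set} (xs : List A) x → length (xs ∷ʳ x) ≡ suc (length xs)
length-∷ʳ [] x = refl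
length-∷ʳ (y ∷ xs) x = cong suc (length-∷ʳ xs x)

-- Rotating a flag vector with a parity correction

parityDiffers : ℕ → ℕ → Bool
parityDiffers m n = not (m % 2 ≡ᵇ n % 2)

parityDiffers-≡ : ∀ m n → m % 2 ≡ n % 2 → parityDiffers m n ≡ false
parityDiffers-≡ m n same with m % 2 ≡ᵇ n % 2 | ≡ᵇ-reflects-≡ (m % 2) (n % 2)
... | true | _ = refl
... | false | ofⁿ differ = ⊥-elim (differ same)

parityDiffers-suc : ∀ m n → m % 2 ≡ n % 2 → parityDiffers (suc m) n ≡ true
parityDiffers-suc m n same with suc m % 2 ≡ᵇ n % 2 | ≡ᵇ-reflects-≡ (suc m % 2) (n % 2)
... | true | ofʸ same′ = ⊥-elim (suc-%2-≢ m (trans same′ (sym same)))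
... | false | _ = refl

-- A and B play the roles of ℓ_{N>O} and ℓ_{N<O} as functions of the flags of a fixed partition.
module FlagRotation (A B : List Bool → ℕ) where

  lastFlag : Bool → List Bool → Bool
  lastFlag f fs = if or fs then parityDiffers (B (fs ∷ʳ false)) (A (f ∷ fs)) else f

  firstFlag : List Bool → Bool → Bool
  firstFlag fs x = if or fs then parityDiffers (A (false ∷ fs)) (B (fs ∷ʳ x)) else x

  lastFlag-unflagged : ∀ f fs → or fs ≡ false → lastFlag f fs ≡ f
  lastFlag-unflagged f fs e rewrite e = refl

  firstFlag-unflagged : ∀ fs x → or fs ≡ false → firstFlag fs x ≡ x
  firstFlag-unflagged fs x e rewrite e = refl

  rotate : List Bool → List Bool
  rotate [] = []
  rotate (f ∷ fs) = fs ∷ʳ lastFlag f fs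

  unrotate : List Bool → List Bool
  unrotate gs with initLast gs
  ... | [] = []
  ... | fs ∷ʳ′ x = firstFlag fs x ∷ fs

  unrotate-∷ʳ : ∀ fs x → unrotate (fs ∷ʳ x) ≡ firstFlag fs x ∷ fs
  unrotate-∷ʳ fs x rewrite initLast-∷ʳ fs x = refl

  length-rotate : ∀ fs → length (rotate fs) ≡ length fs
  length-rotate [] = refl
  length-rotate (f ∷ fs) = length-∷ʳ fs (lastFlag f fs)

  or-rotate : ∀ fs → or (rotate fs) ≡ or fs
  or-rotate [] = refl
  or-rotate (f ∷ fs) = trans (or-∷ʳ fs (lastFlag f fs)) (absorb (or fs) _)
    where
    absorb : ∀ b x → b ∨ (if b then x else f) ≡ f ∨ b
    absorb true x = sym (Bool.∨-zeroʳ f)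
    absorb false x = sym (Bool.∨-identityʳ f)

  length-unrotate : ∀ gs → length (unrotate gs) ≡ length gs
  length-unrotate gs with initLast gs
  ... | [] = refl
  ... | fs ∷ʳ′ x = sym (length-∷ʳ fs x)

  or-unrotate : ∀ gs → or (unrotate gs) ≡ or gs
  or-unrotate gs with initLast gs
  ... | [] = refl
  ... | fs ∷ʳ′ x = trans (absorb (or fs) _) (sym (or-∷ʳ fs x))
    where
    absorb : ∀ b y → (if b then y else x) ∨ b ≡ b ∨ x
    absorb true y = Bool.∨-zeroʳ y
    absorb false y = Bool.∨-identityʳ x

  module Laws {k : ℕ}
    (flipˡ : ∀ fs → length fs ≡ k → or fs ≡ true → A (false ∷ fs) ≡ suc (A (true ∷ fs)))
    (flipʳ : ∀ fs → length fs ≡ k → or fs ≡ true → B (fs ∷ʳ false) ≡ suc (B (fs ∷ʳ true)))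
    (unflagged : ∀ f fs → length fs ≡ k → or fs ≡ false → A (f ∷ fs) ≡ B (fs ∷ʳ f))
    where

    lastFlag-parity : ∀ f fs → length fs ≡ k → B (fs ∷ʳ lastFlag f fs) % 2 ≡ A (f ∷ fs) % 2
    lastFlag-parity f fs len with or fs in e
    ... | false = cong (_% 2) (sym (unflagged f fs len e))
    ... | true with B (fs ∷ʳ false) % 2 ≡ᵇ A (f ∷ fs) % 2 | ≡ᵇ-reflects-≡ (B (fs ∷ʳ false) % 2) (A (f ∷ fs) % 2)
    ...   | true | ofʸ same = same
    ...   | false | ofⁿ differ =
      %2-suc-≡ (B (fs ∷ʳ true)) (A (f ∷ fs)) (subst (λ b → b % 2 ≢ A (f ∷ fs) % 2) (flipʳ fs len e) differ)

    firstFlag-parity : ∀ fs x → length fs ≡ k → A (firstFlag fs x ∷ fs) % 2 ≡ B (fs ∷ʳ x) % 2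
    firstFlag-parity fs x len with or fs in e
    ... | false = cong (_% 2) (unflagged x fs len e)
    ... | true with A (false ∷ fs) % 2 ≡ᵇ B (fs ∷ʳ x) % 2 | ≡ᵇ-reflects-≡ (A (false ∷ fs) % 2) (B (fs ∷ʳ x) % 2)
    ...   | true | ofʸ same = same
    ...   | false | ofⁿ differ =
      %2-suc-≡ (A (true ∷ fs)) (B (fs ∷ʳ x)) (subst (λ a → a % 2 ≢ B (fs ∷ʳ x) % 2) (flipˡ fs len e) differ)

    firstFlag-correct : ∀ f fs x → length fs ≡ k → B (fs ∷ʳ x) % 2 ≡ A (f ∷ fs) % 2 →
                        (or fs ≡ false → x ≡ f) → firstFlag fs x ≡ f
    firstFlag-correct f fs x len parity plain with or fs in e
    ... | false = plain refl
    firstFlag-correct false fs x len parity plain | true = parityDiffers-≡ (A (false ∷ fs)) (B (fs ∷ʳ x)) (sym parity)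
    firstFlag-correct true fs x len parity plain | true rewrite flipˡ fs len e = parityDiffers-suc (A (true ∷ fs)) (B (fs ∷ʳ x)) (sym parity)

    lastFlag-correct : ∀ f fs x → length fs ≡ k → A (f ∷ fs) % 2 ≡ B (fs ∷ʳ x) % 2 →
                       (or fs ≡ false → f ≡ x) → lastFlag f fs ≡ x
    lastFlag-correct f fs x len parity plain with or fs in e
    ... | false = plain refl
    lastFlag-correct f fs false len parity plain | true = parityDiffers-≡ (B (fs ∷ʳ false)) (A (f ∷ fs)) (sym parity)
    lastFlag-correct f fs true len parity plain | true rewrite flipʳ fs len e = parityDiffers-suc (B (fs ∷ʳ true)) (A (f ∷ fs)) (sym parity)

    rotate-parity : ∀ gs → length gs ≡ suc k → B (rotate gs) % 2 ≡ A gs % 2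
    rotate-parity (f ∷ fs) len = lastFlag-parity f fs (suc-injective len)

    unrotate-parity : ∀ gs → length gs ≡ suc k → A (unrotate gs) % 2 ≡ B gs % 2
    unrotate-parity gs len with initLast gs
    ... | fs ∷ʳ′ x = firstFlag-parity fs x (suc-injective (trans (sym (length-∷ʳ fs x)) len))

    unrotate-rotate : ∀ gs → length gs ≡ suc k → unrotate (rotate gs) ≡ gs
    unrotate-rotate (f ∷ fs) len = trans (unrotate-∷ʳ fs (lastFlag f fs))
      (cong (_∷ fs) (firstFlag-correct f fs (lastFlag f fs) (suc-injective len) (lastFlag-parity f fs (suc-injective len))
                       (lastFlag-unflagged f fs)))

    rotate-unrotate : ∀ gs → length gs ≡ suc k → rotate (unrotate gs) ≡ gs
    rotate-unrotate gs len with initLast gs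
    ... | fs ∷ʳ′ x = cong (fs ∷ʳ_) (lastFlag-correct (firstFlag fs x) fs x len′ (firstFlag-parity fs x len′)
                                       (firstFlag-unflagged fs x))
      where len′ : length fs ≡ k
            len′ = suc-injective (trans (sym (length-∷ʳ fs x)) len)

-- Partitions with flags on their heads

sizes : List Part → List ℕ
sizes = map proj₁

Positive : List Part → Set
Positive = All (λ q → 1 ≤ proj₁ q)

-- The Maybe argument is the size of the preceding part (nothing at the start of the list);
-- a head is the first occurrence of a size.
isHead : Maybe ℕ → ℕ → Bool
isHead nothing t = true
isHead (just s) t = not (s ≡ᵇ t)

headCount : Maybe ℕ → List ℕ → ℕ
headCount p [] = 0
headCount p (t ∷ ns) = if isHead p t then suc (headCount (just t) ns) else headCount (just t) ns

headFlags : Maybe ℕ → List Part → List Bool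
headFlags p [] = []
headFlags p ((t , b) ∷ π) = if isHead p t then b ∷ headFlags (just t) π else headFlags (just t) π

-- Missing flags default to false.
overline : Maybe ℕ → List Bool → List ℕ → List Part
overline p fs [] = []
overline p fs (t ∷ ns) with isHead p t
overline p fs       (t ∷ ns) | false = (t , false) ∷ overline (just t) fs ns
overline p []       (t ∷ ns) | true  = (t , false) ∷ overline (just t) [] ns
overline p (f ∷ fs) (t ∷ ns) | true  = (t , f) ∷ overline (just t) fs ns

sizes-overline : ∀ p fs ns → sizes (overline p fs ns) ≡ ns
sizes-overline p fs [] = refl
sizes-overline p fs (t ∷ ns) with isHead p t | fs
... | false | fs′ = cong (t ∷_) (sizes-overline (just t) fs′ ns)
... | true | [] = cong (t ∷_) (sizes-overline (just t) [] ns)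
... | true | f ∷ fs′ = cong (t ∷_) (sizes-overline (just t) fs′ ns)

headFlags-overline : ∀ p fs ns → length fs ≡ headCount p ns → headFlags p (overline p fs ns) ≡ fs
headFlags-overline p [] [] len = refl
headFlags-overline p fs (t ∷ ns) len with isHead p t in head
headFlags-overline p fs (t ∷ ns) len | false rewrite head = headFlags-overline (just t) fs ns len
headFlags-overline p (f ∷ fs) (t ∷ ns) len | true rewrite head = cong (f ∷_) (headFlags-overline (just t) fs ns (suc-injective len))

length-headFlags : ∀ p π → length (headFlags p π) ≡ headCount p (sizes π)
length-headFlags p [] = refl
length-headFlags p ((t , b) ∷ π) with isHead p t
... | false = length-headFlags (just t) π
... | true = cong suc (length-headFlags (just t) π)

overline-headFlags-after : ∀ t c π → Linked AdjOK ((t , c) ∷ π) →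
                           overline (just t) (headFlags (just t) π) (sizes π) ≡ π
overline-headFlags-after t c [] _ = refl
overline-headFlags-after t c ((u , y) ∷ π) (t~u ∷ l) with t ≡ᵇ u | ≡ᵇ-reflects-≡ t u
... | false | ofⁿ _ = cong ((u , y) ∷_) (overline-headFlags-after u y π l)
... | true | ofʸ refl with t~u
...   | inj₁ t<t = ⊥-elim (<-irrefl refl t<t)
...   | inj₂ (_ , refl) = cong ((t , false) ∷_) (overline-headFlags-after t false π l)

overline-headFlags : ∀ π → Linked AdjOK π → overline nothing (headFlags nothing π) (sizes π) ≡ π
overline-headFlags [] _ = refl
overline-headFlags ((t , b) ∷ π) l = cong ((t , b) ∷_) (overline-headFlags-after t b π l)

AdjOK⇒≥ : ∀ {p q} → AdjOK p q → proj₁ p ≥ proj₁ q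
AdjOK⇒≥ (inj₁ q<p) = <⇒≤ q<p
AdjOK⇒≥ (inj₂ (refl , _)) = ≤-refl

sizes-nonincreasing : ∀ {π} → Linked AdjOK π → Linked _≥_ (sizes π)
sizes-nonincreasing l = Linked.map⁺ (Linked.map (λ {p} {q} → AdjOK⇒≥ {p} {q}) l)

Linked-overline-after : ∀ t x fs ns → Linked _≥_ (t ∷ ns) → Linked AdjOK ((t , x) ∷ overline (just t) fs ns)
Linked-overline-after t x fs [] _ = [-]
Linked-overline-after t x fs (u ∷ ns) (u≤t ∷ l) with t ≡ᵇ u | ≡ᵇ-reflects-≡ t u | fs
... | true  | ofʸ refl | fs′    = inj₂ (refl , refl) ∷ Linked-overline-after t false fs′ ns l
... | false | ofⁿ t≢u | []     = inj₁ (≤∧≢⇒< u≤t (t≢u ∘ sym)) ∷ Linked-overline-after u false [] ns l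
... | false | ofⁿ t≢u | f ∷ fs′ = inj₁ (≤∧≢⇒< u≤t (t≢u ∘ sym)) ∷ Linked-overline-after u f fs′ ns l

Linked-overline : ∀ fs ns → Linked _≥_ ns → Linked AdjOK (overline nothing fs ns)
Linked-overline fs [] _ = []
Linked-overline [] (t ∷ ns) l = Linked-overline-after t false [] ns l
Linked-overline (f ∷ fs) (t ∷ ns) l = Linked-overline-after t f fs ns l

sizeSum≡sum-sizes : ∀ π → sizeSum π ≡ sum (sizes π)
sizeSum≡sum-sizes [] = refl
sizeSum≡sum-sizes ((t , _) ∷ π) = cong (t +_) (sizeSum≡sum-sizes π)

overline-positive : ∀ p fs ns → All (1 ≤_) ns → Positive (overline p fs ns)
overline-positive p fs ns positive = All.map⁻ (subst (All (1 ≤_)) (sym (sizes-overline p fs ns)) positive)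

overline-isOverpartition : ∀ {n} fs π → IsOverpartition n π → IsOverpartition n (overline nothing fs (sizes π))
overline-isOverpartition {n} fs π (positive , linked , total) =
    overline-positive nothing fs (sizes π) (All.map⁺ positive)
  , Linked-overline fs (sizes π) (sizes-nonincreasing linked)
  , (begin
      sizeSum π′        ≡⟨ sizeSum≡sum-sizes π′ ⟩
      sum (sizes π′)    ≡⟨ cong sum same-sizes ⟩
      sum (sizes π)     ≡⟨ sizeSum≡sum-sizes π ⟨
      sizeSum π         ≡⟨ total ⟩
      n                 ∎)
  where
  π′ = overline nothing fs (sizes π)
  same-sizes : sizes π′ ≡ sizes π
  same-sizes = sizes-overline nothing fs (sizes π)

overlinedSizes-overline-[] : ∀ p ns → overlinedSizes (overline p [] ns) ≡ []
overlinedSizes-overline-[] p [] = refl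
overlinedSizes-overline-[] p (t ∷ ns) with isHead p t
... | false = overlinedSizes-overline-[] (just t) ns
... | true = overlinedSizes-overline-[] (just t) ns

overline-unflagged : ∀ p fs ns → or fs ≡ false → overline p fs ns ≡ overline p [] ns
overline-unflagged p fs [] _ = refl
overline-unflagged p fs (t ∷ ns) plain with isHead p t | fs
... | false | fs′ = cong ((t , false) ∷_) (overline-unflagged (just t) fs′ ns plain)
... | true | [] = refl
... | true | false ∷ fs′ = cong ((t , false) ∷_) (overline-unflagged (just t) fs′ ns plain)

overlinedSizes-overline-unflagged : ∀ p fs ns → or fs ≡ false → overlinedSizes (overline p fs ns) ≡ []
overlinedSizes-overline-unflagged p fs ns plain =
  trans (cong overlinedSizes (overline-unflagged p fs ns plain)) (overlinedSizes-overline-[] p ns)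

overline-hasOverlined : ∀ p fs ns → length fs ≡ headCount p ns → or fs ≡ true → HasOverlined (overline p fs ns)
overline-hasOverlined p [] [] _ ()
overline-hasOverlined p fs (t ∷ ns) len flagged with isHead p t
... | false = overline-hasOverlined (just t) fs ns len flagged
overline-hasOverlined p (true ∷ fs) (t ∷ ns) len flagged | true = t , _ , refl
overline-hasOverlined p (false ∷ fs) (t ∷ ns) len flagged | true = overline-hasOverlined (just t) fs ns (suc-injective len) flagged

hasOverlined⇒or-headFlags : ∀ π → Linked AdjOK π → HasOverlined π → or (headFlags nothing π) ≡ true
hasOverlined⇒or-headFlags π l (t , ts , ov≡) with or (headFlags nothing π) in plain
... | true = refl
... | false with () ← begin
      t ∷ ts                                                            ≡⟨ ov≡ ⟨
      overlinedSizes π                                                  ≡⟨ cong overlinedSizes (overline-headFlags π l) ⟨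
      overlinedSizes (overline nothing (headFlags nothing π) (sizes π)) ≡⟨ overlinedSizes-overline-unflagged nothing _ (sizes π) plain ⟩
      []                                                                ∎

unflagged-after-lastHead : ∀ d fs ns → headCount (just d) ns ≡ 0 → All (_≡ (d , false)) (overline (just d) fs ns)
unflagged-after-lastHead d fs [] _ = []
unflagged-after-lastHead d fs (u ∷ ns) none with d ≡ᵇ u | ≡ᵇ-reflects-≡ d u
... | true | ofʸ refl = refl ∷ unflagged-after-lastHead d fs ns none
... | false | _ with () ← none

record LastHead (p : Maybe ℕ) (fs : List Bool) (ns : List ℕ) : Set where
  field
    before : List Part
    size : ℕ
    after : List Part
    after-unflagged : All (_≡ (size , false)) after
    overline-∷ʳ : ∀ b → overline p (fs ∷ʳ b) ns ≡ before ++ (size , b) ∷ after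

lastHead : ∀ p fs ns → suc (length fs) ≡ headCount p ns → LastHead p fs ns
lastHead p fs (t ∷ ns) len with isHead p t in head
... | false = record { LastHead r ; before = (t , false) ∷ before
                     ; overline-∷ʳ = λ b → trans (unfold b) (cong ((t , false) ∷_) (overline-∷ʳ b)) }
  where r = lastHead (just t) fs ns len
        open LastHead r
        unfold : ∀ b → overline p (fs ∷ʳ b) (t ∷ ns) ≡ (t , false) ∷ overline (just t) (fs ∷ʳ b) ns
        unfold b rewrite head = refl
lastHead p [] (t ∷ ns) len | true = record
  { before = [] ; size = t ; after = overline (just t) [] ns
  ; after-unflagged = unflagged-after-lastHead t [] ns (sym (suc-injective len))
  ; overline-∷ʳ = unfold }
  where unfold : ∀ b → overline p (b ∷ []) (t ∷ ns) ≡ (t , b) ∷ overline (just t) [] ns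
        unfold b rewrite head = refl
lastHead p (f ∷ fs) (t ∷ ns) len | true = record { LastHead r ; before = (t , f) ∷ before
                     ; overline-∷ʳ = λ b → trans (unfold b) (cong ((t , f) ∷_) (overline-∷ʳ b)) }
  where r = lastHead (just t) fs ns (suc-injective len)
        open LastHead r
        unfold : ∀ b → overline p (f ∷ fs ∷ʳ b) (t ∷ ns) ≡ (t , f) ∷ overline (just t) (fs ∷ʳ b) ns
        unfold b rewrite head = refl

-- The statistics under a change of one flag

max⁺ : ℕ → List ℕ → ℕ
max⁺ x [] = x
max⁺ x (y ∷ ys) = x ⊔ max⁺ y ys

min⁺ : ℕ → List ℕ → ℕ
min⁺ x [] = x
min⁺ x (y ∷ ys) = x ⊓ min⁺ y ys

maximumM-∷ : ∀ x xs → maximumM (x ∷ xs) ≡ just (max⁺ x xs)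
maximumM-∷ x [] = refl
maximumM-∷ x (y ∷ ys) rewrite maximumM-∷ y ys = refl

minimumM-∷ : ∀ x xs → minimumM (x ∷ xs) ≡ just (min⁺ x xs)
minimumM-∷ x [] = refl
minimumM-∷ x (y ∷ ys) rewrite minimumM-∷ y ys = refl

max⁺-∷ʳ : ∀ x xs d → max⁺ x (xs ∷ʳ d) ≡ max⁺ x xs ⊔ d
max⁺-∷ʳ x [] d = refl
max⁺-∷ʳ x (y ∷ ys) d = trans (cong (x ⊔_) (max⁺-∷ʳ y ys d)) (sym (⊔-assoc x (max⁺ y ys) d))

≤-max⁺ : ∀ x xs → x ≤ max⁺ x xs
≤-max⁺ x [] = ≤-refl
≤-max⁺ x (y ∷ ys) = m≤m⊔n x (max⁺ y ys)

min⁺-≤ : ∀ x xs → min⁺ x xs ≤ x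
min⁺-≤ x [] = ≤-refl
min⁺-≤ x (y ∷ ys) = m⊓n≤m x (min⁺ y ys)

SO-∷ : ∀ π a as → overlinedSizes π ≡ a ∷ as → SO π ≡ min⁺ a as
SO-∷ π a as ov≡ rewrite ov≡ | minimumM-∷ a as = refl

SO-[] : ∀ π → overlinedSizes π ≡ [] → SO π ≡ 0
SO-[] π ov≡ rewrite ov≡ = refl

LO∞-∷ : ∀ π a as → overlinedSizes π ≡ a ∷ as → LO∞ π ≡ just (max⁺ a as)
LO∞-∷ π a as ov≡ = trans (cong maximumM ov≡) (maximumM-∷ a as)

overlinedSizes-++ : ∀ xs ys → overlinedSizes (xs ++ ys) ≡ overlinedSizes xs ++ overlinedSizes ys
overlinedSizes-++ [] ys = refl
overlinedSizes-++ ((t , true) ∷ xs) ys = cong (t ∷_) (overlinedSizes-++ xs ys)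
overlinedSizes-++ ((t , false) ∷ xs) ys = overlinedSizes-++ xs ys

overlinedSizes-unflagged : ∀ d ys → All (_≡ (d , false)) ys → overlinedSizes ys ≡ []
overlinedSizes-unflagged d [] [] = refl
overlinedSizes-unflagged d (_ ∷ ys) (refl ∷ plain) = overlinedSizes-unflagged d ys plain

overlinedSizes-++-unflagged : ∀ xs d b ys → All (_≡ (d , false)) ys →
                              overlinedSizes (xs ++ (d , b) ∷ ys) ≡ overlinedSizes xs ++ overlinedSizes ((d , b) ∷ [])
overlinedSizes-++-unflagged xs d b ys plain =
  trans (overlinedSizes-++ xs ((d , b) ∷ ys)) (cong (overlinedSizes xs ++_) (drop-unflagged b))
  where
  drop-unflagged : ∀ b → overlinedSizes ((d , b) ∷ ys) ≡ overlinedSizes ((d , b) ∷ [])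
  drop-unflagged true = cong (d ∷_) (overlinedSizes-unflagged d ys plain)
  drop-unflagged false = overlinedSizes-unflagged d ys plain

All-overlinedSizes : ∀ {P : ℕ → Set} xs → All (P ∘ proj₁) xs → All P (overlinedSizes xs)
All-overlinedSizes [] [] = []
All-overlinedSizes ((t , true) ∷ xs) (p ∷ ps) = p ∷ All-overlinedSizes xs ps
All-overlinedSizes ((t , false) ∷ xs) (p ∷ ps) = All-overlinedSizes xs ps

overlinedSizes-before-lastHead : ∀ {p fs ns} (h : LastHead p fs ns) →
                                 overlinedSizes (overline p (fs ∷ʳ false) ns) ≡ overlinedSizes (LastHead.before h)
overlinedSizes-before-lastHead {p} {fs} {ns} h = begin
  overlinedSizes (overline p (fs ∷ʳ false) ns)        ≡⟨ cong overlinedSizes (overline-∷ʳ false) ⟩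
  overlinedSizes (before ++ (size , false) ∷ after)  ≡⟨ overlinedSizes-++-unflagged before size false after after-unflagged ⟩
  overlinedSizes before ++ []                         ≡⟨ ++-identityʳ (overlinedSizes before) ⟩
  overlinedSizes before                               ∎
  where open LastHead h

countNon-++ : ∀ P xs ys → countNon P (xs ++ ys) ≡ countNon P xs + countNon P ys
countNon-++ P [] ys = refl
countNon-++ P ((t , true) ∷ xs) ys = countNon-++ P xs ys
countNon-++ P ((t , false) ∷ xs) ys =
  trans (cong ((if P t then 1 else 0) +_) (countNon-++ P xs ys)) (sym (+-assoc (if P t then 1 else 0) _ _))

countNon-cong : ∀ P Q π → All (λ q → P (proj₁ q) ≡ Q (proj₁ q)) π → countNon P π ≡ countNon Q π
countNon-cong P Q [] [] = refl
countNon-cong P Q ((t , true) ∷ π) (_ ∷ same) = countNon-cong P Q π same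
countNon-cong P Q ((t , false) ∷ π) (e ∷ same) = cong₂ (λ b n → (if b then 1 else 0) + n) e (countNon-cong P Q π same)

countNon-none : ∀ P π → All (λ q → P (proj₁ q) ≡ false) π → countNon P π ≡ 0
countNon-none P [] [] = refl
countNon-none P ((t , true) ∷ π) (_ ∷ none) = countNon-none P π none
countNon-none P ((t , false) ∷ π) (e ∷ none) rewrite e = countNon-none P π none

sizes-below-head : ∀ t c R → Linked AdjOK ((t , c) ∷ R) → All (λ q → proj₁ q ≤ t) R
sizes-below-head t c [] _ = []
sizes-below-head t c ((u , y) ∷ R) (t~u ∷ l) = u≤t ∷ All.map (λ v≤u → ≤-trans v≤u u≤t) (sizes-below-head u y R l)
  where u≤t = AdjOK⇒≥ {t , c} {u , y} t~u

overlinedSizes-below-head : ∀ t c R → Linked AdjOK ((t , c) ∷ R) → All (_< t) (overlinedSizes R)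
overlinedSizes-below-head t c [] _ = []
overlinedSizes-below-head t c ((u , true) ∷ R) (inj₁ u<t ∷ l) =
  u<t ∷ All.map (λ v<u → <-trans v<u u<t) (overlinedSizes-below-head u true R l)
overlinedSizes-below-head t c ((u , false) ∷ R) (t~u ∷ l) =
  All.map (λ v<u → <-≤-trans v<u u≤t) (overlinedSizes-below-head u false R l)
  where u≤t = AdjOK⇒≥ {t , c} {u , false} t~u

sizes-above-overlined : ∀ xs d ys → Linked AdjOK (xs ++ (d , true) ∷ ys) → All (λ q → d < proj₁ q) xs
sizes-above-overlined [] d ys _ = []
sizes-above-overlined ((t , c) ∷ xs) d ys l = d<t ∷ sizes-above-overlined xs d ys (Linked.tail l)
  where
  below : All (_< t) (overlinedSizes xs ++ overlinedSizes ((d , true) ∷ ys))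
  below = subst (All (_< t)) (overlinedSizes-++ xs ((d , true) ∷ ys)) (overlinedSizes-below-head t c _ l)
  d<t : d < t
  d<t with d<t ∷ _ ← All.++⁻ʳ (overlinedSizes xs) below = d<t

ℓN>O-unflag-first : ∀ t R → Linked AdjOK ((t , true) ∷ R) → HasOverlined R →
                    ℓN>O ((t , false) ∷ R) ≡ suc (ℓN>O ((t , true) ∷ R))
ℓN>O-unflag-first t R l (a , as , ov≡) = begin
  ℓN>O ((t , false) ∷ R)                          ≡⟨ cong (λ s → countNon (s <ᵇ_) ((t , false) ∷ R)) (SO-∷ R a as ov≡) ⟩
  (if m <ᵇ t then 1 else 0) + countNon (m <ᵇ_) R  ≡⟨ cong (λ b → (if b then 1 else 0) + countNon (m <ᵇ_) R) (<ᵇ-true m<t) ⟩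
  suc (countNon (m <ᵇ_) R)                        ≡⟨ cong (λ s → suc (countNon (s <ᵇ_) R)) SO-head ⟨
  suc (ℓN>O ((t , true) ∷ R))                     ∎
  where
  m = min⁺ a as
  m<t : m < t
  m<t with a<t ∷ _ ← subst (All (_< t)) ov≡ (overlinedSizes-below-head t true R l) = ≤-<-trans (min⁺-≤ a as) a<t
  SO-head : SO ((t , true) ∷ R) ≡ m
  SO-head = trans (SO-∷ ((t , true) ∷ R) t (a ∷ as) (cong (t ∷_) ov≡)) (m≥n⇒m⊓n≡n (<⇒≤ m<t))

ℓN>O-only-first-overlined : ∀ t R → Linked AdjOK ((t , true) ∷ R) → overlinedSizes R ≡ [] → ℓN>O ((t , true) ∷ R) ≡ 0
ℓN>O-only-first-overlined t R l ov≡ = begin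
  ℓN>O ((t , true) ∷ R)  ≡⟨ cong (λ s → countNon (s <ᵇ_) R) (SO-∷ ((t , true) ∷ R) t [] (cong (t ∷_) ov≡)) ⟩
  countNon (t <ᵇ_) R     ≡⟨ countNon-none (t <ᵇ_) R (All.map <ᵇ-false (sizes-below-head t true R l)) ⟩
  0                      ∎

ℓN<O-unflag-last : ∀ xs d ys → Linked AdjOK (xs ++ (d , true) ∷ ys) → All (_≡ (d , false)) ys → HasOverlined xs →
                   ℓN<O (xs ++ (d , false) ∷ ys) ≡ suc (ℓN<O (xs ++ (d , true) ∷ ys))
ℓN<O-unflag-last xs d ys l plain (a , as , ov≡) = begin
  ℓN<O (xs ++ (d , false) ∷ ys)                              ≡⟨ cong (λ L → countNon (_<∞ᵇ L) (xs ++ (d , false) ∷ ys)) LO-unflagged ⟩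
  countNon P (xs ++ (d , false) ∷ ys)                        ≡⟨ countNon-++ P xs ((d , false) ∷ ys) ⟩
  countNon P xs + ((if d <ᵇ M then 1 else 0) + countNon P ys) ≡⟨ cong (λ b → countNon P xs + ((if b then 1 else 0) + countNon P ys)) (<ᵇ-true d<M) ⟩
  countNon P xs + suc (countNon P ys)                        ≡⟨ +-suc (countNon P xs) (countNon P ys) ⟩
  suc (countNon P xs + countNon P ys)                        ≡⟨ cong suc (countNon-++ P xs ((d , true) ∷ ys)) ⟨
  suc (countNon P (xs ++ (d , true) ∷ ys))                   ≡⟨ cong (λ L → suc (countNon (_<∞ᵇ L) (xs ++ (d , true) ∷ ys))) LO-flagged ⟨
  suc (ℓN<O (xs ++ (d , true) ∷ ys))                         ∎
  where
  M = max⁺ a as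
  P : ℕ → Bool
  P = _<ᵇ M
  d<M : d < M
  d<M with d<a ∷ _ ← subst (All (d <_)) ov≡ (All-overlinedSizes xs (sizes-above-overlined xs d ys l)) = <-≤-trans d<a (≤-max⁺ a as)
  LO-unflagged : LO∞ (xs ++ (d , false) ∷ ys) ≡ just M
  LO-unflagged = LO∞-∷ (xs ++ (d , false) ∷ ys) a as (trans (overlinedSizes-++-unflagged xs d false ys plain) (trans (++-identityʳ (overlinedSizes xs)) ov≡))
  LO-flagged : LO∞ (xs ++ (d , true) ∷ ys) ≡ just M
  LO-flagged = begin
    LO∞ (xs ++ (d , true) ∷ ys)  ≡⟨ LO∞-∷ (xs ++ (d , true) ∷ ys) a (as ∷ʳ d) (trans (overlinedSizes-++-unflagged xs d true ys plain) (cong (_∷ʳ d) ov≡)) ⟩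
    just (max⁺ a (as ∷ʳ d))     ≡⟨ cong just (max⁺-∷ʳ a as d) ⟩
    just (M ⊔ d)                ≡⟨ cong just (m≥n⇒m⊔n≡m (<⇒≤ d<M)) ⟩
    just M                      ∎

ℓN<O-only-last-overlined : ∀ xs d ys → Linked AdjOK (xs ++ (d , true) ∷ ys) → All (_≡ (d , false)) ys →
                           overlinedSizes xs ≡ [] → ℓN<O (xs ++ (d , true) ∷ ys) ≡ 0
ℓN<O-only-last-overlined xs d ys l plain ov≡ = begin
  ℓN<O (xs ++ (d , true) ∷ ys)            ≡⟨ cong (λ L → countNon (_<∞ᵇ L) (xs ++ (d , true) ∷ ys)) LO-last ⟩
  countNon (_<ᵇ d) (xs ++ (d , true) ∷ ys) ≡⟨ countNon-++ (_<ᵇ d) xs ((d , true) ∷ ys) ⟩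
  countNon (_<ᵇ d) xs + countNon (_<ᵇ d) ys ≡⟨ cong₂ _+_ (countNon-none (_<ᵇ d) xs (All.map (<ᵇ-false ∘ <⇒≤) (sizes-above-overlined xs d ys l)))
                                                        (countNon-none (_<ᵇ d) ys (All.map (λ { {_ , _} refl → <ᵇ-false {d} ≤-refl }) plain)) ⟩
  0                                        ∎
  where
  LO-last : LO∞ (xs ++ (d , true) ∷ ys) ≡ just d
  LO-last = LO∞-∷ (xs ++ (d , true) ∷ ys) d [] (trans (overlinedSizes-++-unflagged xs d true ys plain) (cong (_++ d ∷ []) ov≡))

ℓN>O≡ℓN<O-unflagged : ∀ π → overlinedSizes π ≡ [] → Positive π → ℓN>O π ≡ ℓN<O π
ℓN>O≡ℓN<O-unflagged π ov≡ positive = begin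
  ℓN>O π                     ≡⟨ cong (λ s → countNon (s <ᵇ_) π) (SO-[] π ov≡) ⟩
  countNon (0 <ᵇ_) π         ≡⟨ countNon-cong (0 <ᵇ_) (λ _ → true) π (All.map <ᵇ-true positive) ⟩
  countNon (λ _ → true) π    ≡⟨ cong (λ L → countNon (_<∞ᵇ L) π) (cong maximumM ov≡) ⟨
  ℓN<O π                     ∎

Linked-lastHead : ∀ {fs ns} (h : LastHead nothing fs ns) → Linked _≥_ ns →
                  Linked AdjOK (LastHead.before h ++ (LastHead.size h , true) ∷ LastHead.after h)
Linked-lastHead {fs} {ns} h l = subst (Linked AdjOK) (LastHead.overline-∷ʳ h true) (Linked-overline (fs ∷ʳ true) ns l)

ℓN>O-overline-unflag-first : ∀ t ns → Linked _≥_ (t ∷ ns) → ∀ fs → length fs ≡ headCount (just t) ns → or fs ≡ true →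
                             ℓN>O (overline nothing (false ∷ fs) (t ∷ ns)) ≡ suc (ℓN>O (overline nothing (true ∷ fs) (t ∷ ns)))
ℓN>O-overline-unflag-first t ns l fs len flagged =
  ℓN>O-unflag-first t (overline (just t) fs ns) (Linked-overline (true ∷ fs) (t ∷ ns) l)
                    (overline-hasOverlined (just t) fs ns len flagged)

ℓN<O-overline-unflag-last : ∀ t ns → Linked _≥_ (t ∷ ns) → ∀ fs → length fs ≡ headCount (just t) ns → or fs ≡ true →
                            ℓN<O (overline nothing (fs ∷ʳ false) (t ∷ ns)) ≡ suc (ℓN<O (overline nothing (fs ∷ʳ true) (t ∷ ns)))
ℓN<O-overline-unflag-last t ns l fs len flagged = begin
  ℓN<O (overline nothing (fs ∷ʳ false) (t ∷ ns))      ≡⟨ cong ℓN<O (overline-∷ʳ false) ⟩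
  ℓN<O (before ++ (size , false) ∷ after)             ≡⟨ ℓN<O-unflag-last before size after linked after-unflagged hasOverlined-before ⟩
  suc (ℓN<O (before ++ (size , true) ∷ after))        ≡⟨ cong (suc ∘ ℓN<O) (overline-∷ʳ true) ⟨
  suc (ℓN<O (overline nothing (fs ∷ʳ true) (t ∷ ns))) ∎
  where
  h = lastHead nothing fs (t ∷ ns) (cong suc len)
  open LastHead h
  linked = Linked-lastHead h l
  hasOverlined-before : HasOverlined before
  hasOverlined-before with a , as , ov≡ ← overline-hasOverlined nothing (fs ∷ʳ false) (t ∷ ns)
                                           (trans (length-∷ʳ fs false) (cong suc len))
                                           (trans (or-∷ʳ-false fs) flagged)
    = a , as , trans (sym (overlinedSizes-before-lastHead h)) ov≡

ℓN>O-overline≡ℓN<O-overline : ∀ t ns → Linked _≥_ (t ∷ ns) → All (1 ≤_) (t ∷ ns) → ∀ f fs → length fs ≡ headCount (just t) ns →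
                              or fs ≡ false → ℓN>O (overline nothing (f ∷ fs) (t ∷ ns)) ≡ ℓN<O (overline nothing (fs ∷ʳ f) (t ∷ ns))
ℓN>O-overline≡ℓN<O-overline t ns l positive false fs len plain = begin
  ℓN>O (overline nothing (false ∷ fs) (t ∷ ns))  ≡⟨ cong ℓN>O (overline-unflagged nothing (false ∷ fs) (t ∷ ns) plain) ⟩
  ℓN>O (overline nothing [] (t ∷ ns))            ≡⟨ ℓN>O≡ℓN<O-unflagged (overline nothing [] (t ∷ ns))
                                                      (overlinedSizes-overline-[] nothing (t ∷ ns))
                                                      (overline-positive nothing [] (t ∷ ns) positive) ⟩
  ℓN<O (overline nothing [] (t ∷ ns))            ≡⟨ cong ℓN<O (overline-unflagged nothing (fs ∷ʳ false) (t ∷ ns) (trans (or-∷ʳ-false fs) plain)) ⟨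
  ℓN<O (overline nothing (fs ∷ʳ false) (t ∷ ns)) ∎
ℓN>O-overline≡ℓN<O-overline t ns l positive true fs len plain = begin
  ℓN>O (overline nothing (true ∷ fs) (t ∷ ns))  ≡⟨ ℓN>O-only-first-overlined t (overline (just t) fs ns) (Linked-overline (true ∷ fs) (t ∷ ns) l)
                                                     (overlinedSizes-overline-unflagged (just t) fs ns plain) ⟩
  0                                             ≡⟨ ℓN<O-only-last-overlined before size after (Linked-lastHead h l) after-unflagged before-unflagged ⟨
  ℓN<O (before ++ (size , true) ∷ after)        ≡⟨ cong ℓN<O (overline-∷ʳ true) ⟨
  ℓN<O (overline nothing (fs ∷ʳ true) (t ∷ ns)) ∎
  where
  h = lastHead nothing fs (t ∷ ns) (cong suc len)
  open LastHead h
  before-unflagged : overlinedSizes before ≡ []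
  before-unflagged = trans (sym (overlinedSizes-before-lastHead h)) (overlinedSizes-overline-unflagged nothing (fs ∷ʳ false) (t ∷ ns) (trans (or-∷ʳ-false fs) plain))

module HeadFlagRotation (ns : List ℕ) =
  FlagRotation (λ fs → ℓN>O (overline nothing fs ns)) (λ fs → ℓN<O (overline nothing fs ns))

module RotationLaws (t : ℕ) (ns : List ℕ) (l : Linked _≥_ (t ∷ ns)) (positive : All (1 ≤_) (t ∷ ns)) =
  HeadFlagRotation.Laws (t ∷ ns) (ℓN>O-overline-unflag-first t ns l) (ℓN<O-overline-unflag-last t ns l) (ℓN>O-overline≡ℓN<O-overline t ns l positive)

mapHeadFlags : (List ℕ → List Bool → List Bool) → List Part → List Part
mapHeadFlags g π = overline nothing (g (sizes π) (headFlags nothing π)) (sizes π)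

mapHeadFlags-mapHeadFlags : ∀ g h π → length (g (sizes π) (headFlags nothing π)) ≡ length (headFlags nothing π) →
  mapHeadFlags h (mapHeadFlags g π) ≡ overline nothing (h (sizes π) (g (sizes π) (headFlags nothing π))) (sizes π)
mapHeadFlags-mapHeadFlags g h π len =
  cong₂ (λ ns fs → overline nothing (h ns fs) ns)
        (sizes-overline nothing G (sizes π))
        (headFlags-overline nothing G (sizes π) (trans len (length-headFlags nothing π)))
  where G = g (sizes π) (headFlags nothing π)

rotateFlags : List Part → List Part
rotateFlags = mapHeadFlags HeadFlagRotation.rotate

unrotateFlags : List Part → List Part
unrotateFlags = mapHeadFlags HeadFlagRotation.unrotate

ℓN<O-rotateFlags : ∀ π → Linked AdjOK π → Positive π → ℓN<O (rotateFlags π) % 2 ≡ ℓN>O π % 2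
ℓN<O-rotateFlags [] _ _ = refl
ℓN<O-rotateFlags π@((t , _) ∷ ρ) l positive = begin
  ℓN<O (rotateFlags π) % 2                                        ≡⟨ rotate-parity (headFlags nothing π) (length-headFlags nothing π) ⟩
  ℓN>O (overline nothing (headFlags nothing π) (sizes π)) % 2     ≡⟨ cong (λ π′ → ℓN>O π′ % 2) (overline-headFlags π l) ⟩
  ℓN>O π % 2                                                      ∎
  where open RotationLaws t (sizes ρ) (sizes-nonincreasing l) (All.map⁺ positive)

ℓN>O-unrotateFlags : ∀ π → Linked AdjOK π → Positive π → ℓN>O (unrotateFlags π) % 2 ≡ ℓN<O π % 2
ℓN>O-unrotateFlags [] _ _ = refl
ℓN>O-unrotateFlags π@((t , _) ∷ ρ) l positive = begin
  ℓN>O (unrotateFlags π) % 2                                      ≡⟨ unrotate-parity (headFlags nothing π) (length-headFlags nothing π) ⟩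
  ℓN<O (overline nothing (headFlags nothing π) (sizes π)) % 2     ≡⟨ cong (λ π′ → ℓN<O π′ % 2) (overline-headFlags π l) ⟩
  ℓN<O π % 2                                                      ∎
  where open RotationLaws t (sizes ρ) (sizes-nonincreasing l) (All.map⁺ positive)

unrotateFlags-rotateFlags : ∀ π → Linked AdjOK π → Positive π → unrotateFlags (rotateFlags π) ≡ π
unrotateFlags-rotateFlags [] _ _ = refl
unrotateFlags-rotateFlags π@((t , _) ∷ ρ) l positive = begin
  unrotateFlags (rotateFlags π)                  ≡⟨ mapHeadFlags-mapHeadFlags HeadFlagRotation.rotate HeadFlagRotation.unrotate π (length-rotate F) ⟩
  overline nothing (unrotate (rotate F)) (sizes π) ≡⟨ cong (λ fs → overline nothing fs (sizes π)) (unrotate-rotate F (length-headFlags nothing π)) ⟩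
  overline nothing F (sizes π)                   ≡⟨ overline-headFlags π l ⟩
  π                                              ∎
  where
  open HeadFlagRotation (sizes π)
  open RotationLaws t (sizes ρ) (sizes-nonincreasing l) (All.map⁺ positive)
  F = headFlags nothing π

rotateFlags-unrotateFlags : ∀ π → Linked AdjOK π → Positive π → rotateFlags (unrotateFlags π) ≡ π
rotateFlags-unrotateFlags [] _ _ = refl
rotateFlags-unrotateFlags π@((t , _) ∷ ρ) l positive = begin
  rotateFlags (unrotateFlags π)                  ≡⟨ mapHeadFlags-mapHeadFlags HeadFlagRotation.unrotate HeadFlagRotation.rotate π (length-unrotate F) ⟩
  overline nothing (rotate (unrotate F)) (sizes π) ≡⟨ cong (λ fs → overline nothing fs (sizes π)) (rotate-unrotate F (length-headFlags nothing π)) ⟩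
  overline nothing F (sizes π)                   ≡⟨ overline-headFlags π l ⟩
  π                                              ∎
  where
  open HeadFlagRotation (sizes π)
  open RotationLaws t (sizes ρ) (sizes-nonincreasing l) (All.map⁺ positive)
  F = headFlags nothing π

hasOverlined-rotateFlags : ∀ π → Linked AdjOK π → HasOverlined π → HasOverlined (rotateFlags π)
hasOverlined-rotateFlags π l h =
  overline-hasOverlined nothing (rotate F) (sizes π) (trans (length-rotate F) (length-headFlags nothing π))
                        (trans (or-rotate F) (hasOverlined⇒or-headFlags π l h))
  where open HeadFlagRotation (sizes π)
        F = headFlags nothing π

hasOverlined-unrotateFlags : ∀ π → Linked AdjOK π → HasOverlined π → HasOverlined (unrotateFlags π)
hasOverlined-unrotateFlags π l h =
  overline-hasOverlined nothing (unrotate F) (sizes π) (trans (length-unrotate F) (length-headFlags nothing π))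
                        (trans (or-unrotate F) (hasOverlined⇒or-headFlags π l h))
  where open HeadFlagRotation (sizes π)
        F = headFlags nothing π

Σ-↔ : ∀ {A : Set} {P Q : A → Set} → (∀ {x} → Irrelevant (P x)) → (∀ {x} → Irrelevant (Q x)) →
      (f g : A → A) → (∀ {x} → P x → Q (f x)) → (∀ {x} → Q x → P (g x)) →
      (∀ {x} → P x → g (f x) ≡ x) → (∀ {x} → Q x → f (g x) ≡ x) → Σ A P ↔ Σ A Q
Σ-↔ P-irrelevant Q-irrelevant f g f-maps g-maps g∘f f∘g = mk↔ₛ′
  (λ (x , p) → f x , f-maps p) (λ (y , q) → g y , g-maps q)
  (λ (y , q) → Σ-≡,≡→≡ (f∘g q , Q-irrelevant _ _))
  (λ (x , p) → Σ-≡,≡→≡ (g∘f p , P-irrelevant _ _))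

AdjOK-irrelevant : ∀ {p q} → Irrelevant (AdjOK p q)
AdjOK-irrelevant (inj₁ x) (inj₁ y) = cong inj₁ (<-irrelevant x y)
AdjOK-irrelevant (inj₁ x) (inj₂ (e , _)) = ⊥-elim (<-irrefl e x)
AdjOK-irrelevant (inj₂ (e , _)) (inj₁ x) = ⊥-elim (<-irrefl e x)
AdjOK-irrelevant (inj₂ (e , f)) (inj₂ (e′ , f′)) = cong inj₂ (cong₂ _,_ (≡-irrelevant e e′) (Bool-≡-irrelevant f f′))
  where Bool-≡-irrelevant = Decidable⇒UIP.≡-irrelevant Bool._≟_

IsOverpartition-irrelevant : ∀ n π → Irrelevant (IsOverpartition n π)
IsOverpartition-irrelevant n π (a , l , s) (a′ , l′ , s′) =
  cong₂ _,_ (All.irrelevant ≤-irrelevant a a′)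
            (cong₂ _,_ (Linked.irrelevant (λ {p} {q} → AdjOK-irrelevant {p} {q}) l l′) (≡-irrelevant s s′))

HasOverlined-irrelevant : ∀ π → Irrelevant (HasOverlined π)
HasOverlined-irrelevant π (a , as , e) (a′ , as′ , e′) with refl ← trans (sym e) e′ =
  cong (λ e″ → a , as , e″) (Decidable⇒UIP.≡-irrelevant (≡-dec _≟_) e e′)

overpartition-bijection : ∀ n {P Q : List Part → Set} → (∀ π → Irrelevant (P π)) → (∀ π → Irrelevant (Q π)) →
  (∀ {π} → Linked AdjOK π → Positive π → P π → Q (rotateFlags π)) →
  (∀ {π} → Linked AdjOK π → Positive π → Q π → P (unrotateFlags π)) →
  OverpartitionsWith n P ↔ OverpartitionsWith n Q
overpartition-bijection n P-irrelevant Q-irrelevant rotate-maps unrotate-maps =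
  Σ-↔ (λ {π} (o , p) (o′ , p′) → cong₂ _,_ (IsOverpartition-irrelevant n π o o′) (P-irrelevant π p p′))
      (λ {π} (o , q) (o′ , q′) → cong₂ _,_ (IsOverpartition-irrelevant n π o o′) (Q-irrelevant π q q′))
      rotateFlags unrotateFlags
      (λ {π} (o@(positive , l , _) , p) → overline-isOverpartition _ π o , rotate-maps l positive p)
      (λ {π} (o@(positive , l , _) , q) → overline-isOverpartition _ π o , unrotate-maps l positive q)
      (λ {π} ((positive , l , _) , _) → unrotateFlags-rotateFlags π l positive)
      (λ {π} ((positive , l , _) , _) → rotateFlags-unrotateFlags π l positive)

parity-bijection : ∀ n k → OverpartitionsWith n (λ π → ℓN>O π % 2 ≡ k) ↔ OverpartitionsWith n (λ λ′ → ℓN<O λ′ % 2 ≡ k)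
parity-bijection n k = overpartition-bijection n (λ _ → ≡-irrelevant) (λ _ → ≡-irrelevant)
  (λ {π} l positive parity → trans (ℓN<O-rotateFlags π l positive) parity)
  (λ {π} l positive parity → trans (ℓN>O-unrotateFlags π l positive) parity)

overlined-parity-bijection : ∀ n k →
  OverpartitionsWith n (λ π → HasOverlined π × ℓN>O π % 2 ≡ k) ↔ OverpartitionsWith n (λ λ′ → HasOverlined λ′ × ℓN<O λ′ % 2 ≡ k)
overlined-parity-bijection n k = overpartition-bijection n (irrelevant ℓN>O) (irrelevant ℓN<O)
  (λ {π} l positive (h , parity) → hasOverlined-rotateFlags π l h , trans (ℓN<O-rotateFlags π l positive) parity)
  (λ {π} l positive (h , parity) → hasOverlined-unrotateFlags π l h , trans (ℓN>O-unrotateFlags π l positive) parity)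
  where
  irrelevant : ∀ (ℓ : List Part → ℕ) π → Irrelevant (HasOverlined π × ℓ π % 2 ≡ k)
  irrelevant ℓ π (h , e) (h′ , e′) = cong₂ _,_ (HasOverlined-irrelevant π h h′) (≡-irrelevant e e′)

-- The bijections exist for n = 0 as well.
corollary1p6 : (n : ℕ) → 1 ≤ n →
    ((OverpartitionsWith n (λ π → ℓN>O π % 2 ≡ 0) ↔ OverpartitionsWith n (λ λ' → ℓN<O λ' % 2 ≡ 0))
     × (OverpartitionsWith n (λ π → ℓN>O π % 2 ≡ 1) ↔ OverpartitionsWith n (λ λ' → ℓN<O λ' % 2 ≡ 1)))
    × ((OverpartitionsWith n (λ π → HasOverlined π × ℓN>O π % 2 ≡ 0) ↔ OverpartitionsWith n (λ λ' → HasOverlined λ' × ℓN<O λ' % 2 ≡ 0))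
     × (OverpartitionsWith n (λ π → HasOverlined π × ℓN>O π % 2 ≡ 1) ↔ OverpartitionsWith n (λ λ' → HasOverlined λ' × ℓN<O λ' % 2 ≡ 1)))
corollary1p6 n _ = (parity-bijection n 0 , parity-bijection n 1) , (overlined-parity-bijection n 0 , overlined-parity-bijection n 1)
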